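{- Let $\mathbb{D}=\{a+b\varepsilon: a,b\in\mathbb{R}\}$ be the algebra of dual numbers ($\varepsilon^2=0$). Let $(F_n)_{n\in\mathbb{Z}}$ and $(L_n)_{n\in\mathbb{Z}}$ be the Fibonacci and Lucas numbers. Define, for $n\ge0$, $$A_n=F_{2n-1}+L_{2n-1}\varepsilon,\qquad \tilde A_n=F_{2n}+L_{2n}\varepsilon.$$ Then for all $n\ge0$, $$A_{n+2}A_n=A_{n+1}^2+1\qquad\text{and}\qquad \tilde A_{n+2}\tilde A_n=\tilde A_{n+1}^2-1$$ in $\mathbb{D}$. Equivalently, with $a_n=F_{2n-1}$, $b_n=L_{2n-1}$, $\tilde a_n=F_{2n}$, $\tilde b_n=L_{2n}$, one has $b_{n+2}a_n=2b_{n+1}a_{n+1}-b_na_{n+2}$ and $\tilde b_{n+2}\tilde a_n=2\tilde b_{n+1}\tilde a_{n+1}-\tilde b_n\tilde a_{n+2}$.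
   Context: $F_n=(\varphi^n-(-\varphi)^{ -n})/\sqrt5$ and $L_n=\varphi^n+(-\varphi)^{ -n}$ for all $n\in\mathbb{Z}$, where $\varphi$ is the golden ratio; thus $F_0=0,F_1=1$, $L_0=2,L_1=1$, $F_{ -1}=1$, $L_{ -1}=-1$. -}

module Defs where

open import Data.Nat as ℕ using (ℕ; zero; suc)
open import Data.Integer using (ℤ; +_; -[1+_]; _+_; _*_; _-_; -_; 1ℤ; 0ℤ)

fibℕ : ℕ → ℕ
fibℕ zero = 0
fibℕ (suc zero) = 1
fibℕ (suc (suc n)) = fibℕ (suc n) ℕ.+ fibℕ n

lucℕ : ℕ → ℕ
lucℕ zero = 2
lucℕ (suc zero) = 1
lucℕ (suc (suc n)) = lucℕ (suc n) ℕ.+ lucℕ n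

sgn : ℕ → ℤ
sgn zero = 1ℤ
sgn (suc m) = - sgn m

-- Extension to ℤ, agreeing with the Binet formulas:
-- F_{-k} = (-1)^{k+1} F_k,  L_{-k} = (-1)^k L_k.  Here -[1+ m] = -(m+1).
F : ℤ → ℤ
F (+ n) = + fibℕ n
F -[1+ m ] = sgn m * + fibℕ (suc m)

L : ℤ → ℤ
L (+ n) = + lucℕ n
L -[1+ m ] = sgn (suc m) * + lucℕ (suc m)

-- Dual numbers a + b ε with ε² = 0 (integer coefficients suffice: all
-- numbers involved are integers and ℤ[ε] ⊂ ℝ[ε] is a subring).
record Dual : Set where
  constructor _+ε_
  field
    re : ℤ
    du : ℤ
open Dual public

infixl 6 _+D_ _-D_
infixl 7 _*D_

_+D_ : Dual → Dual → Dual
(a +ε b) +D (c +ε d) = (a + c) +ε (b + d)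

_-D_ : Dual → Dual → Dual
(a +ε b) -D (c +ε d) = (a - c) +ε (b - d)

_*D_ : Dual → Dual → Dual
(a +ε b) *D (c +ε d) = (a * c) +ε (a * d + b * c)

1D : Dual
1D = 1ℤ +ε 0ℤ

A : ℕ → Dual
A n = F (+ (2 ℕ.* n) - 1ℤ) +ε L (+ (2 ℕ.* n) - 1ℤ)

Ã : ℕ → Dual
Ã n = F (+ (2 ℕ.* n)) +ε L (+ (2 ℕ.* n))

-- Put D j = F j + L j ε for j ∈ ℕ.  As L j = 2 F (j+1) − F j, the dual numbers
-- D j, D (j+2), D (j+4) are linear in the pair (F j, F (j+1)), and a polynomial
-- identity reduces D (j+4) D j − D (j+2)² to minus the Cassini form
-- F (j+1)² − F (j+1) F j − F j², which is (−1)^j.  Now Ã n = D (2n) and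
-- A n = D (2n−1) for n ≥ 1 (A 0 involves F (−1), L (−1), and n = 0 is checked by
-- computation).  The coefficient identities are the ε-parts of the dual ones.
module Submission where

open import Defs
open import Function using (_∘_)
open import Data.Nat as ℕ using (ℕ; zero; suc)
open import Data.Nat.Properties using (*-suc)
open import Data.Integer using (ℤ; +_; _+_; _*_; _-_; -_; 1ℤ; 0ℤ)
open import Data.Integer.Properties using (pos-+; neg-involutive)
open import Data.Integer.Tactic.RingSolver using (solve-∀)
open import Data.Product using (_×_; _,_)
open import Relation.Binary.PropositionalEquality
  using (_≡_; refl; sym; trans; cong; cong₂; module ≡-Reasoning)
open ≡-Reasoning

-- Since x -D (c +ε 0ℤ) unfolds to x +D (- c +ε 0ℤ), this covers both signs.
square+scalar⇒du-identity : ∀ x y z c → x *D y ≡ z *D z +D (c +ε 0ℤ)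
                            → du x * re y ≡ (+ 2) * du z * re z - du y * re x
square+scalar⇒du-identity x y z c eq = begin
  du x * re y
    ≡⟨ isolate (re x) (du y) (du x) (re y) ⟩
  (re x * du y + du x * re y) - du y * re x
    ≡⟨ cong (_- du y * re x) (cong du eq) ⟩
  (re z * du z + du z * re z + 0ℤ) - du y * re x
    ≡⟨ collect (re z) (du z) (du y * re x) ⟩
  (+ 2) * du z * re z - du y * re x
    ∎
  where
  isolate : ∀ a b c d → c * d ≡ (a * b + c * d) - b * a
  isolate = solve-∀
  collect : ∀ a b e → (a * b + b * a + 0ℤ) - e ≡ (+ 2) * b * a - e
  collect = solve-∀

fib luc : ℕ → ℤ
fib j = + fibℕ j
luc j = + lucℕ j

D : ℕ → Dual
D j = fib j +ε luc j

fib-+2 : ∀ j → fib (2 ℕ.+ j) ≡ fib (suc j) + fib j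
fib-+2 j = pos-+ (fibℕ (suc j)) (fibℕ j)

luc-+2 : ∀ j → luc (2 ℕ.+ j) ≡ luc (suc j) + luc j
luc-+2 j = pos-+ (lucℕ (suc j)) (lucℕ j)

luc≡2fib-fib : ∀ j → luc j ≡ (+ 2) * fib (suc j) - fib j
luc≡2fib-fib zero = refl
luc≡2fib-fib (suc zero) = refl
luc≡2fib-fib (suc (suc j)) = begin
  luc (2 ℕ.+ j)
    ≡⟨ luc-+2 j ⟩
  luc (1 ℕ.+ j) + luc j
    ≡⟨ cong₂ _+_ (luc≡2fib-fib (suc j)) (luc≡2fib-fib j) ⟩
  ((+ 2) * fib (2 ℕ.+ j) - fib (1 ℕ.+ j)) + ((+ 2) * fib (1 ℕ.+ j) - fib j)
    ≡⟨ regroup (fib (2 ℕ.+ j)) (fib (1 ℕ.+ j)) (fib j) ⟩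
  (+ 2) * (fib (2 ℕ.+ j) + fib (1 ℕ.+ j)) - (fib (1 ℕ.+ j) + fib j)
    ≡⟨ sym (cong₂ (λ a b → (+ 2) * a - b) (fib-+2 (1 ℕ.+ j)) (fib-+2 j)) ⟩
  (+ 2) * fib (3 ℕ.+ j) - fib (2 ℕ.+ j)
    ∎
  where
  regroup : ∀ a b c → ((+ 2) * a - b) + ((+ 2) * b - c) ≡ (+ 2) * (a + b) - (b + c)
  regroup = solve-∀

sgn-even : ∀ m → sgn (2 ℕ.* m) ≡ 1ℤ
sgn-even zero = refl
sgn-even (suc m) = begin
  sgn (2 ℕ.* suc m)  ≡⟨ cong sgn (*-suc 2 m) ⟩
  - - sgn (2 ℕ.* m)  ≡⟨ neg-involutive _ ⟩
  sgn (2 ℕ.* m)      ≡⟨ sgn-even m ⟩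
  1ℤ                 ∎

fibPair : ℕ → ℤ × ℤ
fibPair j = fib j , fib (suc j)

next2 : ℤ × ℤ → ℤ × ℤ
next2 (x , y) = y + x , (y + x) + y

fibPair-+2 : ∀ j → fibPair (2 ℕ.+ j) ≡ next2 (fibPair j)
fibPair-+2 j = cong₂ _,_ (fib-+2 j) (trans (fib-+2 (suc j)) (cong (_+ fib (suc j)) (fib-+2 j)))

cassini : ℤ × ℤ → ℤ
cassini (x , y) = y * y - y * x - x * x

cassini-fibPair : ∀ j → cassini (fibPair j) ≡ sgn j
cassini-fibPair zero = refl
cassini-fibPair (suc j) = begin
  cassini (fibPair (suc j))        ≡⟨ cong (λ z → cassini (fib (suc j) , z)) (fib-+2 j) ⟩
  cassini (fib (suc j) , fib (suc j) + fib j)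
                                   ≡⟨ cassini-step (fib j) (fib (suc j)) ⟩
  - cassini (fibPair j)            ≡⟨ cong -_ (cassini-fibPair j) ⟩
  - sgn j                          ∎
  where
  cassini-step : ∀ x y → (y + x) * (y + x) - (y + x) * y - y * y ≡ - (y * y - y * x - x * x)
  cassini-step = solve-∀

fibDual : ℤ × ℤ → Dual
fibDual (x , y) = x +ε ((+ 2) * y - x)

D≡fibDual : ∀ j → D j ≡ fibDual (fibPair j)
D≡fibDual j = cong (fib j +ε_) (luc≡2fib-fib j)

fibDual-catalan : ∀ p → fibDual (next2 (next2 p)) *D fibDual p
                        ≡ fibDual (next2 p) *D fibDual (next2 p) +D ((- cassini p) +ε 0ℤ)
fibDual-catalan (x , y) = cong₂ _+ε_ (re-part x y) (du-part x y)
  where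
  -- spelled out, as solve-∀ does not unfold next2 and fibDual
  re-part : ∀ x y → (((y + x) + y) + (y + x)) * x
                    ≡ (y + x) * (y + x) + - (y * y - y * x - x * x)
  re-part = solve-∀
  du-part : ∀ x y → (((y + x) + y) + (y + x)) * ((+ 2) * y - x)
                    + ((+ 2) * ((((y + x) + y) + (y + x)) + ((y + x) + y)) - (((y + x) + y) + (y + x))) * x
                    ≡ (y + x) * ((+ 2) * ((y + x) + y) - (y + x))
                    + ((+ 2) * ((y + x) + y) - (y + x)) * (y + x) + 0ℤ
  du-part = solve-∀

D-catalan : ∀ j → D (4 ℕ.+ j) *D D j ≡ D (2 ℕ.+ j) *D D (2 ℕ.+ j) +D ((- sgn j) +ε 0ℤ)
D-catalan j = begin
  D (4 ℕ.+ j) *D D j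
    ≡⟨ cong₂ _*D_ (D≡fibDual (4 ℕ.+ j)) (D≡fibDual j) ⟩
  fibDual (fibPair (4 ℕ.+ j)) *D fibDual p
    ≡⟨ cong (λ q → fibDual q *D fibDual p) (trans (fibPair-+2 (2 ℕ.+ j)) (cong next2 (fibPair-+2 j))) ⟩
  fibDual (next2 (next2 p)) *D fibDual p
    ≡⟨ fibDual-catalan p ⟩
  fibDual (next2 p) *D fibDual (next2 p) +D ((- cassini p) +ε 0ℤ)
    ≡⟨ cong₂ (λ d c → d *D d +D ((- c) +ε 0ℤ))
             (sym (trans (D≡fibDual (2 ℕ.+ j)) (cong fibDual (fibPair-+2 j))))
             (cassini-fibPair j) ⟩
  D (2 ℕ.+ j) *D D (2 ℕ.+ j) +D ((- sgn j) +ε 0ℤ)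
    ∎
  where p = fibPair j

D-catalan-at : ∀ j {s x₀ x₁ x₂} → - sgn j ≡ s → x₀ ≡ D j → x₁ ≡ D (2 ℕ.+ j) → x₂ ≡ D (4 ℕ.+ j)
               → x₂ *D x₀ ≡ x₁ *D x₁ +D (s +ε 0ℤ)
D-catalan-at j refl refl refl refl = D-catalan j

*-suc-suc : ∀ m n → m ℕ.* suc (suc n) ≡ m ℕ.+ (m ℕ.+ m ℕ.* n)
*-suc-suc m n = trans (*-suc m (suc n)) (cong (m ℕ.+_) (*-suc m n))

A-suc : ∀ m → A (suc m) ≡ D (suc (2 ℕ.* m))
A-suc m = cong (D ∘ ℕ.pred) (*-suc 2 m)

A-catalan : ∀ n → A (suc (suc n)) *D A n ≡ A (suc n) *D A (suc n) +D 1D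
A-catalan zero = refl
A-catalan (suc m) =
  D-catalan-at (suc (2 ℕ.* m)) (trans (neg-involutive _) (sgn-even m))
    (A-suc m)
    (trans (A-suc (suc m)) (cong (D ∘ suc) (*-suc 2 m)))
    (trans (A-suc (2 ℕ.+ m)) (cong (D ∘ suc) (*-suc-suc 2 m)))

Ã-catalan : ∀ n → Ã (suc (suc n)) *D Ã n ≡ Ã (suc n) *D Ã (suc n) -D 1D
Ã-catalan n =
  D-catalan-at (2 ℕ.* n) (cong -_ (sgn-even n)) refl (cong D (*-suc 2 n)) (cong D (*-suc-suc 2 n))

proposition1 : (n : ℕ) →
    (A (suc (suc n)) *D A n ≡ A (suc n) *D A (suc n) +D 1D)
    × (Ã (suc (suc n)) *D Ã n ≡ Ã (suc n) *D Ã (suc n) -D 1D)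
    × (du (A (suc (suc n))) * re (A n)
        ≡ (+ 2) * du (A (suc n)) * re (A (suc n)) - du (A n) * re (A (suc (suc n))))
    × (du (Ã (suc (suc n))) * re (Ã n)
        ≡ (+ 2) * du (Ã (suc n)) * re (Ã (suc n)) - du (Ã n) * re (Ã (suc (suc n))))
proposition1 n =
  A-catalan n , Ã-catalan n ,
  square+scalar⇒du-identity (A (suc (suc n))) (A n) (A (suc n)) 1ℤ (A-catalan n) ,
  square+scalar⇒du-identity (Ã (suc (suc n))) (Ã n) (Ã (suc n)) (- 1ℤ) (Ã-catalan n)
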